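{- Every deterministic online algorithm for MPMD-Set with size-based delay has competitive ratio $\Omega(n)$, where $n$ is the number of points in the metric space.
   Context: MPMD-Set with size-based delay: a metric space $(V,d)$ with $n$ points; requests arrive online at points of $V$ at discrete timesteps; the algorithm irrevocably matches requests in pairs, eventually producing a perfect matching; at each timestep $t$ a delay function $f_t$ on sets of requests is charged on the set $U_t$ of arrived-but-unmatched requests, where $f_t(\emptyset)=0$, $f_t$ is monotone under inclusion, $\sum_t f_t(U)=\infty$ for nonempty $U$, and $f_t(U)$ depends only on $|U|$ and is non-decreasing in $|U|$. Total cost is the sum of distances of matched pairs plus $\sum_t f_t(U_t)$. Competitive ratio $c$: cost at most $c$ times optimal offline cost on every instance. -}

module Defs where

open import Data.Nat using (ℕ; zero; suc; _+_; _*_; _∸_; _≤_; _<_; _⊔_; _≤?_; _≟_)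
open import Data.List using (List; []; _∷_; length; filter; map; upTo; concatMap; foldr)
open import Data.Nat.ListAction using (sum)
open import Data.Bool.ListAction using (any)
open import Data.List.Relation.Unary.All using (All)
open import Data.List.Relation.Unary.Linked using (Linked)
open import Data.List.Relation.Binary.Permutation.Propositional using (_↭_)
open import Data.Product using (_×_; _,_; proj₁; proj₂; ∃)
open import Data.Bool using (Bool; true; false; _∨_)
open import Data.Maybe using (Maybe; just; nothing)
open import Data.Fin using (Fin)
open import Data.Empty using (⊥)
open import Relation.Nullary.Decidable using (⌊_⌋)
open import Relation.Binary.PropositionalEquality using (_≡_)

sumUpTo : (ℕ → ℕ) → ℕ → ℕ
sumUpTo f T = sum (map f (upTo T))

IsMetric : ∀ {n} → (Fin n → Fin n → ℕ) → Set
IsMetric {n} d =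
  (∀ x → d x x ≡ 0) × (∀ x y → d x y ≡ 0 → x ≡ y) ×
  (∀ x y → d x y ≡ d y x) × (∀ x y z → d x z ≤ d x y + d y z)

-- Size-based delay: f_t(U) = g t |U|.  Conditions:
-- f_t(∅) = 0, non-decreasing in |U| (hence monotone under inclusion),
-- and Σ_t f_t(U) = ∞ for every nonempty U (i.e. for every size k ≥ 1).
SizeBasedDelay : (ℕ → ℕ → ℕ) → Set
SizeBasedDelay g =
  (∀ t → g t 0 ≡ 0) ×
  (∀ t k l → k ≤ l → g t k ≤ g t l) ×
  (∀ k → 1 ≤ k → ∀ B → ∃ λ T → B ≤ sumUpTo (λ t → g t k) T)

-- A request: (arrival time, location).
Request : ℕ → Set
Request n = ℕ × Fin n

-- An instance is a finite list of requests listed in order of arrival time;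
-- request identities are positions in this list.
SortedByArrival : ∀ {n} → List (Request n) → Set
SortedByArrival = Linked (λ r s → proj₁ r ≤ proj₁ s)

arrived : ∀ {n} → ℕ → List (Request n) → List (Request n)
arrived t = filter (λ r → proj₁ r ≤? t)

locAt : ∀ {n} → List (Request n) → ℕ → Maybe (Fin n)
locAt [] _ = nothing
locAt (r ∷ rs) zero = just (proj₂ r)
locAt (r ∷ rs) (suc i) = locAt rs i

arrAt : ∀ {n} → List (Request n) → ℕ → Maybe ℕ
arrAt [] _ = nothing
arrAt (r ∷ rs) zero = just (proj₁ r)
arrAt (r ∷ rs) (suc i) = arrAt rs i

memℕ : ℕ → List ℕ → Bool
memℕ i = any (λ k → ⌊ k ≟ i ⌋)

-- A deterministic online algorithm: knows the metric; at time t it sees the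
-- requests arrived so far (with arrival times and locations, indexed by
-- position) and the delay functions f_0,…,f_t revealed so far, and outputs
-- pairs (of indices) to match now.  Pairs that are not legal (same request,
-- not yet arrived, or already matched) are ignored, so every such function
-- denotes a legal algorithm and every legal algorithm is of this form.
OnlineAlgorithm : ℕ → Set
OnlineAlgorithm n =
  (Fin n → Fin n → ℕ) → (t : ℕ) → List (Request n) → List (ℕ → ℕ) → List (ℕ × ℕ)

applyPairs : ∀ {n} → (Fin n → Fin n → ℕ) → List (Request n) → List ℕ →
             List (ℕ × ℕ) → List ℕ × ℕ
applyPairs d R M [] = M , 0
applyPairs d R M ((i , j) ∷ ps)
  with locAt R i | locAt R j | ⌊ i ≟ j ⌋ ∨ memℕ i M ∨ memℕ j M
... | just x | just y | false =
  proj₁ (applyPairs d R (i ∷ j ∷ M) ps) , d x y + proj₂ (applyPairs d R (i ∷ j ∷ M) ps)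
... | _ | _ | _ = applyPairs d R M ps

-- state after timesteps 0,…,T-1: matched indices and total cost so far
-- (distances of matched pairs + Σ_{t<T} f_t(U_t)).
algRun : ∀ {n} → OnlineAlgorithm n → (Fin n → Fin n → ℕ) → (ℕ → ℕ → ℕ) →
         List (Request n) → ℕ → List ℕ × ℕ
algRun A d g I zero = [] , 0
algRun A d g I (suc t) =
  proj₁ r , proj₂ (algRun A d g I t) + proj₂ r + g t (length R ∸ length (proj₁ r))
  where
    R = arrived t I
    r = applyPairs d R (proj₁ (algRun A d g I t)) (A d t R (map g (upTo (suc t))))

algCost : ∀ {n} → OnlineAlgorithm n → (Fin n → Fin n → ℕ) → (ℕ → ℕ → ℕ) →
          List (Request n) → ℕ → ℕ
algCost A d g I T = proj₂ (algRun A d g I T)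

-- Offline solution: triples (i , j , τ): requests i and j matched at time τ.
OfflineSolution : Set
OfflineSolution = List (ℕ × ℕ × ℕ)

pairIdx : OfflineSolution → List ℕ
pairIdx = concatMap (λ p → proj₁ p ∷ proj₁ (proj₂ p) ∷ [])

matchTime : ℕ × ℕ × ℕ → ℕ
matchTime p = proj₂ (proj₂ p)

ArrivedBy : ∀ {n} → List (Request n) → ℕ → ℕ → Set
ArrivedBy I i τ with arrAt I i
... | just a = a ≤ τ
... | nothing = ⊥

ValidOffline : ∀ {n} → List (Request n) → OfflineSolution → Set
ValidOffline I S =
  (pairIdx S ↭ upTo (length I)) ×
  All (λ p → ArrivedBy I (proj₁ p) (matchTime p) × ArrivedBy I (proj₁ (proj₂ p)) (matchTime p)) S

distIdx : ∀ {n} → (Fin n → Fin n → ℕ) → List (Request n) → ℕ → ℕ → ℕ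
distIdx d I i j with locAt I i | locAt I j
... | just x | just y = d x y
... | _ | _ = 0

horizon : OfflineSolution → ℕ
horizon S = suc (foldr (λ p m → matchTime p ⊔ m) 0 S)

-- number of arrived-but-unmatched requests at time t (for a valid solution)
offUnmatched : ∀ {n} → List (Request n) → OfflineSolution → ℕ → ℕ
offUnmatched I S t = length (arrived t I) ∸ 2 * length (filter (λ p → matchTime p ≤? t) S)

-- total cost of an offline solution (after the horizon nothing is unmatched)
offCost : ∀ {n} → (Fin n → Fin n → ℕ) → (ℕ → ℕ → ℕ) → List (Request n) → OfflineSolution → ℕ
offCost d g I S =
  sum (map (λ p → distIdx d I (proj₁ p) (proj₁ (proj₂ p))) S) +
  sumUpTo (λ t → g t (offUnmatched I S t)) (horizon S)

module Submission where

-- The adversary works on the uniform metric over N = m + 1 points with a delay that is free up to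
-- time N, costs one per pending request afterwards, and costs a prohibitive penalty whenever N
-- requests are pending.  At time 0 it puts one request on every point but one; at each time
-- t = 1, …, m it puts a request on a point where the algorithm has no pending request, which exists
-- unless the algorithm pays the penalty.  The pending requests of the algorithm then always sit on
-- distinct points, so each of its matches costs 1, and with 2m requests and at most m pending it has
-- paid at least m/2.  Offline, some point w receives no request after time 0.  Matching every request
-- with a pending one on its own point, except that the first request after time 0 is matched with the
-- one on w, keeps at most m requests pending (on distinct points) and costs at most 1; requests at
-- time N on the pending points close everything at no cost.

open import Defs
open import Data.Nat using (ℕ; zero; suc; _+_; _*_; _∸_; _≤_; _<_; _≤?_; _≟_; z≤n; s≤s; _⊔_; >-nonZero)
open import Data.Nat.Properties
open import Data.Nat.Tactic.RingSolver using (solve-∀)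
open import Data.Nat.ListAction using (sum)
open import Data.Nat.ListAction.Properties using (sum-++)
open import Data.Bool using (true; false; T)
open import Data.Maybe using (Maybe; just; nothing)
import Data.Maybe.Properties as Maybe
open import Data.Fin as Fin using (Fin)
import Data.Fin.Properties as Fin
open import Data.Product using (Σ-syntax; ∃; ∃-syntax; _×_; _,_; proj₁; proj₂)
open import Data.Sum using (_⊎_; inj₁; inj₂)
open import Data.Empty using (⊥-elim)
open import Data.List using (List; []; _∷_; _++_; _∷ʳ_; length; map; filter; upTo; allFin; tabulate; foldr; drop; [_])
import Data.List.Properties as List
open import Data.List.Relation.Unary.All as All using (All; []; _∷_)
import Data.List.Relation.Unary.All.Properties as All
open import Data.List.Relation.Unary.Any as Any using (here; there; _─_)
open import Data.List.Relation.Unary.Any.Properties using (any⁺)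
open import Data.List.Relation.Unary.AllPairs as AllPairs using (AllPairs; []; _∷_)
import Data.List.Relation.Unary.AllPairs.Properties as AllPairs
open import Data.List.Relation.Unary.Linked.Properties using (AllPairs⇒Linked)
open import Data.List.Relation.Unary.Unique.Propositional using (Unique)
import Data.List.Relation.Unary.Unique.Propositional.Properties as Unique
open import Data.List.Membership.Propositional using (_∈_; _∉_)
open import Data.List.Membership.Propositional.Properties using (∈-allFin; ∈-upTo⁺; ∈-map⁻)
open import Data.List.Membership.DecPropositional _≟_ using () renaming (_∈?_ to _∈ℕ?_)
open import Data.List.Relation.Binary.Permutation.Propositional
  using (_↭_; ↭-refl; ↭-sym; ↭-trans; ↭-prep; ↭-swap; ↭⇒↭ₛ; module PermutationReasoning)
import Data.List.Relation.Binary.Permutation.Propositional.Properties as Perm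
import Data.List.Relation.Binary.Permutation.Setoid.Properties as PermSetoid
open import Function using (_∘_)
open import Relation.Nullary using (¬_; Dec; yes; no; ¬?; _×-dec_)
open import Relation.Nullary.Decidable using (fromWitness; decidable-stable)
open import Relation.Binary.PropositionalEquality hiding ([_])

-- Counting and extracting list elements

∈-─ : ∀ {A : Set} {x v : A} {ys : List A} (x∈ys : x ∈ ys) → v ∈ ys → x ≢ v → v ∈ (ys ─ x∈ys)
∈-─ (here refl) (here refl) x≢v = ⊥-elim (x≢v refl)
∈-─ (here _)    (there v∈ys) _   = v∈ys
∈-─ (there _)   (here v≡y)   _   = here v≡y
∈-─ (there x∈ys) (there v∈ys) x≢v = there (∈-─ x∈ys v∈ys x≢v)

Unique⇒length≤ : ∀ {A : Set} {xs ys : List A} → Unique xs → (∀ {v} → v ∈ xs → v ∈ ys) →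
                 length xs ≤ length ys
Unique⇒length≤ {xs = []} _ _ = z≤n
Unique⇒length≤ {xs = x ∷ xs} {ys} (x∉xs ∷ u) xs⊆ys = begin
  suc (length xs)          ≤⟨ s≤s (Unique⇒length≤ u λ v∈xs →
                                ∈-─ x∈ys (xs⊆ys (there v∈xs)) (All.lookup x∉xs v∈xs)) ⟩
  suc (length (ys ─ x∈ys)) ≡⟨ List.length-removeAt′ ys (Any.index x∈ys) ⟨
  length ys                ∎
  where
    open ≤-Reasoning
    x∈ys = xs⊆ys (here refl)

Unique⇒length≤n : ∀ {n} {xs : List (Fin n)} → Unique xs → length xs ≤ n
Unique⇒length≤n {n} {xs} u =
  subst (length xs ≤_) (List.length-tabulate (λ i → i)) (Unique⇒length≤ u (λ {v} _ → ∈-allFin v))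

Unique⇒length≤bound : ∀ {xs : List ℕ} {L} → Unique xs → All (_< L) xs → length xs ≤ L
Unique⇒length≤bound {L = L} u xs<L =
  subst (_ ≤_) (List.length-upTo L) (Unique⇒length≤ u (∈-upTo⁺ ∘ All.lookup xs<L))

module _ {n : ℕ} where
  open import Data.List.Membership.DecPropositional (Fin._≟_ {n}) using (_∈?_)

  length<⇒∃∉ : (L : List (Fin n)) → length L < n → ∃ λ p → p ∉ L
  length<⇒∃∉ L L<n = Fin.¬∀⟶∃¬ n (_∈ L) (_∈? L) λ all∈L →
    <⇒≱ L<n (subst (_≤ length L) (List.length-tabulate (λ i → i))
      (Unique⇒length≤ (Unique.allFin⁺ n) (λ {v} _ → all∈L v)))

Unique-resp-↭ : ∀ {A : Set} {xs ys : List A} → xs ↭ ys → Unique xs → Unique ys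
Unique-resp-↭ {A} xs↭ys = PermSetoid.Unique-resp-↭ (setoid A) (↭⇒↭ₛ xs↭ys)

upTo-suc↭ : ∀ k → upTo (suc k) ↭ k ∷ upTo k
upTo-suc↭ k = subst (_↭ k ∷ upTo k) (List.upTo-∷ʳ k) (↭-sym (Perm.∷↭∷ʳ k (upTo k)))

module _ {A : Set} {P : A → Set} (P? : ∀ x → Dec (P x)) where

  extract : List A → Maybe (A × List A)
  extract [] = nothing
  extract (x ∷ xs) with P? x
  ... | yes _ = just (x , xs)
  ... | no _ with extract xs
  ...   | just (y , ys) = just (y , x ∷ ys)
  ...   | nothing       = nothing

  extract-just : ∀ xs {y ys} → extract xs ≡ just (y , ys) → P y × xs ↭ y ∷ ys
  extract-just (x ∷ xs) found with P? x | found
  ... | yes Px | refl = Px , ↭-refl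
  ... | no _   | found′ with extract xs in found″ | found′
  ...   | just (y , ys) | refl =
    let (Py , xs↭) = extract-just xs found″ in Py , ↭-trans (↭-prep x xs↭) (↭-swap x y ↭-refl)

  extract-nothing : ∀ xs → extract xs ≡ nothing → All (¬_ ∘ P) xs
  extract-nothing [] _ = []
  extract-nothing (x ∷ xs) none with P? x | none
  ... | no ¬Px | none′ with extract xs in none″ | none′
  ...   | nothing | refl = ¬Px ∷ extract-nothing xs none″

  extract-none : ∀ {xs} → All (¬_ ∘ P) xs → extract xs ≡ nothing
  extract-none [] = refl
  extract-none {x ∷ xs} (¬Px ∷ ¬Pxs) with P? x
  ... | yes Px = ⊥-elim (¬Px Px)
  ... | no _ rewrite extract-none ¬Pxs = refl

  extract-here : ∀ {x} xs → P x → extract (x ∷ xs) ≡ just (x , xs)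
  extract-here {x} xs Px with P? x
  ... | yes _  = refl
  ... | no ¬Px = ⊥-elim (¬Px Px)

-- The metric and the delay

sumUpTo-suc : ∀ f T → sumUpTo f (suc T) ≡ sumUpTo f T + f T
sumUpTo-suc f T = begin
  sum (map f (upTo (suc T)))        ≡⟨ cong (sum ∘ map f) (List.upTo-∷ʳ T) ⟨
  sum (map f (upTo T ∷ʳ T))         ≡⟨ cong sum (List.map-++ f (upTo T) [ T ]) ⟩
  sum (map f (upTo T) ++ [ f T ])   ≡⟨ sum-++ (map f (upTo T)) [ f T ] ⟩
  sumUpTo f T + (f T + 0)           ≡⟨ cong (sumUpTo f T +_) (+-identityʳ (f T)) ⟩
  sumUpTo f T + f T                 ∎
  where open ≡-Reasoning

sumUpTo-zero : ∀ f T → (∀ t → t < T → f t ≡ 0) → sumUpTo f T ≡ 0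
sumUpTo-zero f zero _ = refl
sumUpTo-zero f (suc T) f≡0 = begin
  sumUpTo f (suc T)  ≡⟨ sumUpTo-suc f T ⟩
  sumUpTo f T + f T  ≡⟨ cong₂ _+_ (sumUpTo-zero f T (λ t t<T → f≡0 t (m<n⇒m<1+n t<T))) (f≡0 T ≤-refl) ⟩
  0                  ∎
  where open ≡-Reasoning

sumUpTo-unbounded : ∀ f s → (∀ t → s ≤ t → 1 ≤ f t) → ∀ B → B ≤ sumUpTo f (s + B)
sumUpTo-unbounded f s f≥1 zero = z≤n
sumUpTo-unbounded f s f≥1 (suc B) = begin
  suc B                              ≡⟨ +-comm 1 B ⟩
  B + 1                              ≤⟨ +-mono-≤ (sumUpTo-unbounded f s f≥1 B) (f≥1 (s + B) (m≤m+n s B)) ⟩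
  sumUpTo f (s + B) + f (s + B)      ≡⟨ sumUpTo-suc f (s + B) ⟨
  sumUpTo f (suc (s + B))            ≡⟨ cong (sumUpTo f) (+-suc s B) ⟨
  sumUpTo f (s + suc B)              ∎
  where open ≤-Reasoning

uniform : ∀ {n} → Fin n → Fin n → ℕ
uniform x y with x Fin.≟ y
... | yes _ = 0
... | no _  = 1

uniform-≡ : ∀ {n} (x : Fin n) → uniform x x ≡ 0
uniform-≡ x with x Fin.≟ x
... | yes _  = refl
... | no x≢x = ⊥-elim (x≢x refl)

uniform-≢ : ∀ {n} {x y : Fin n} → x ≢ y → uniform x y ≡ 1
uniform-≢ {x = x} {y} x≢y with x Fin.≟ y
... | yes x≡y = ⊥-elim (x≢y x≡y)
... | no _    = refl

uniform-≤1 : ∀ {n} (x y : Fin n) → uniform x y ≤ 1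
uniform-≤1 x y with x Fin.≟ y
... | yes _ = z≤n
... | no _  = ≤-refl

uniform-isMetric : ∀ {n} → IsMetric (uniform {n})
uniform-isMetric = uniform-≡ , uniform-zero⇒≡ , uniform-sym , uniform-triangle
  where
    uniform-zero⇒≡ : ∀ x y → uniform x y ≡ 0 → x ≡ y
    uniform-zero⇒≡ x y d≡0 with x Fin.≟ y
    uniform-zero⇒≡ x y d≡0 | yes x≡y = x≡y
    uniform-zero⇒≡ x y ()  | no _
    uniform-sym : ∀ x y → uniform x y ≡ uniform y x
    uniform-sym x y with x Fin.≟ y
    ... | yes refl = sym (uniform-≡ x)
    ... | no x≢y   = sym (uniform-≢ (x≢y ∘ sym))
    uniform-triangle : ∀ x y z → uniform x z ≤ uniform x y + uniform y z
    uniform-triangle x y z with x Fin.≟ z | x Fin.≟ y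
    ... | yes _ | _        = z≤n
    ... | no _  | no _     = s≤s z≤n
    ... | no x≢z | yes refl = ≤-reflexive (sym (uniform-≢ x≢z))

cliffDelay : ℕ → ℕ → ℕ → ℕ → ℕ
cliffDelay N penalty t k with N ≤? k | N <? t
... | yes _ | _     = penalty
... | no _  | yes _ = k
... | no _  | no _  = 0

module _ {N penalty : ℕ} where

  cliffDelay-full : ∀ {t k} → N ≤ k → cliffDelay N penalty t k ≡ penalty
  cliffDelay-full {t} {k} N≤k with N ≤? k
  ... | yes _  = refl
  ... | no N≰k = ⊥-elim (N≰k N≤k)

  cliffDelay-early : ∀ {t k} → k < N → t ≤ N → cliffDelay N penalty t k ≡ 0
  cliffDelay-early {t} {k} k<N t≤N with N ≤? k | N <? t
  ... | yes N≤k | _     = ⊥-elim (<⇒≱ k<N N≤k)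
  ... | no _    | yes N<t = ⊥-elim (<⇒≱ N<t t≤N)
  ... | no _    | no _  = refl

  cliffDelay-late : ∀ {t k} → k < N → N < t → cliffDelay N penalty t k ≡ k
  cliffDelay-late {t} {k} k<N N<t with N ≤? k | N <? t
  ... | yes N≤k | _      = ⊥-elim (<⇒≱ k<N N≤k)
  ... | no _    | yes _  = refl
  ... | no _    | no N≮t = ⊥-elim (N≮t N<t)

  cliffDelay-≤penalty : N ≤ penalty → ∀ t k → cliffDelay N penalty t k ≤ penalty
  cliffDelay-≤penalty N≤p t k with N ≤? k | N <? t
  ... | yes _  | _     = ≤-refl
  ... | no N≰k | yes _ = ≤-trans (<⇒≤ (≰⇒> N≰k)) N≤p
  ... | no _   | no _  = z≤n

  cliffDelay-sizeBased : 1 ≤ N → N ≤ penalty → SizeBasedDelay (cliffDelay N penalty)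
  cliffDelay-sizeBased 1≤N N≤p = at-empty , monotone , divergent
    where
      at-empty : ∀ t → cliffDelay N penalty t 0 ≡ 0
      at-empty t with ≤-<-connex t N
      ... | inj₁ t≤N = cliffDelay-early 1≤N t≤N
      ... | inj₂ N<t = cliffDelay-late 1≤N N<t
      monotone : ∀ t k l → k ≤ l → cliffDelay N penalty t k ≤ cliffDelay N penalty t l
      monotone t k l k≤l with ≤-<-connex N l | ≤-<-connex t N
      ... | inj₁ N≤l | _ = ≤-trans (cliffDelay-≤penalty N≤p t k) (≤-reflexive (sym (cliffDelay-full N≤l)))
      ... | inj₂ l<N | inj₁ t≤N =
        ≤-reflexive (trans (cliffDelay-early (≤-<-trans k≤l l<N) t≤N) (sym (cliffDelay-early l<N t≤N)))
      ... | inj₂ l<N | inj₂ N<t = begin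
        cliffDelay N penalty t k ≡⟨ cliffDelay-late (≤-<-trans k≤l l<N) N<t ⟩
        k                        ≤⟨ k≤l ⟩
        l                        ≡⟨ cliffDelay-late l<N N<t ⟨
        cliffDelay N penalty t l ∎
        where open ≤-Reasoning
      positive-late : ∀ {k} → 1 ≤ k → ∀ t → suc N ≤ t → 1 ≤ cliffDelay N penalty t k
      positive-late {k} 1≤k t N<t with ≤-<-connex N k
      ... | inj₁ N≤k = subst (1 ≤_) (sym (cliffDelay-full N≤k)) (≤-trans 1≤N N≤p)
      ... | inj₂ k<N = subst (1 ≤_) (sym (cliffDelay-late k<N N<t)) 1≤k
      divergent : ∀ k → 1 ≤ k → ∀ B → ∃ λ T → B ≤ sumUpTo (λ t → cliffDelay N penalty t k) T
      divergent k 1≤k B = suc N + B , sumUpTo-unbounded _ (suc N) (positive-late 1≤k) B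

-- Bookkeeping for requests and offline solutions

module _ {n : ℕ} where

  locAt-< : ∀ (R : List (Request n)) i {x} → locAt R i ≡ just x → i < length R
  locAt-< (r ∷ R) zero    _ = s≤s z≤n
  locAt-< (r ∷ R) (suc i) e = s≤s (locAt-< R i e)

  locAt-∈ : ∀ (R : List (Request n)) i {x} → locAt R i ≡ just x → x ∈ map proj₂ R
  locAt-∈ (r ∷ R) zero    refl = here refl
  locAt-∈ (r ∷ R) (suc i) e    = there (locAt-∈ R i e)

  locAt-∷ʳ : ∀ (R : List (Request n)) r i {x} → locAt (R ∷ʳ r) i ≡ just x →
             locAt R i ≡ just x ⊎ (i ≡ length R × x ≡ proj₂ r)
  locAt-∷ʳ []      r zero    refl = inj₂ (refl , refl)
  locAt-∷ʳ (_ ∷ R) r zero    e    = inj₁ e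
  locAt-∷ʳ (_ ∷ R) r (suc i) e with locAt-∷ʳ R r i e
  ... | inj₁ e′            = inj₁ e′
  ... | inj₂ (i≡ , x≡)     = inj₂ (cong suc i≡ , x≡)

  locAt-injective : ∀ (R : List (Request n)) → Unique (map proj₂ R) →
                    ∀ {i j x} → locAt R i ≡ just x → locAt R j ≡ just x → i ≡ j
  locAt-injective (r ∷ R) _       {zero}  {zero}  _ _ = refl
  locAt-injective (r ∷ R) (r∉ ∷ _) {zero}  {suc j} refl e = ⊥-elim (All.lookup r∉ (locAt-∈ R j e) refl)
  locAt-injective (r ∷ R) (r∉ ∷ _) {suc i} {zero}  e refl = ⊥-elim (All.lookup r∉ (locAt-∈ R i e) refl)
  locAt-injective (r ∷ R) (_ ∷ u) {suc i} {suc j} eᵢ eⱼ = cong suc (locAt-injective R u eᵢ eⱼ)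

  arrived-all : ∀ {t} {xs : List (Request n)} → All (λ r → proj₁ r ≤ t) xs → arrived t xs ≡ xs
  arrived-all {t} = List.filter-all (λ r → proj₁ r ≤? t)

  arrived-++-later : ∀ {t} {xs : List (Request n)} ys → All (λ r → t < proj₁ r) ys →
                     arrived t (xs ++ ys) ≡ arrived t xs
  arrived-++-later {t} {xs} ys later = begin
    arrived t (xs ++ ys)          ≡⟨ List.filter-++ (λ r → proj₁ r ≤? t) xs ys ⟩
    arrived t xs ++ arrived t ys  ≡⟨ cong (arrived t xs ++_)
                                       (List.filter-none (λ r → proj₁ r ≤? t) (All.map <⇒≱ later)) ⟩
    arrived t xs ++ []            ≡⟨ List.++-identityʳ _ ⟩
    arrived t xs                  ∎
    where open ≡-Reasoning

  arrivedBy-mono : ∀ (I : List (Request n)) {i τ τ′} → τ ≤ τ′ → ArrivedBy I i τ → ArrivedBy I i τ′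
  arrivedBy-mono I {i} τ≤τ′ by-τ with arrAt I i
  ... | just _ = ≤-trans by-τ τ≤τ′

  arrivedBy-arrAt : ∀ (I : List (Request n)) {i τ} → arrAt I i ≡ just τ → ArrivedBy I i τ
  arrivedBy-arrAt I {i} found with arrAt I i
  arrivedBy-arrAt I refl | just _ = ≤-refl

  drop-∷ : ∀ (I : List (Request n)) k {r rest} → drop k I ≡ r ∷ rest → drop (suc k) I ≡ rest
  drop-∷ (_ ∷ I) zero    refl    = refl
  drop-∷ (_ ∷ I) (suc k) dropped = drop-∷ I k dropped

  drop-located : ∀ (I : List (Request n)) k {r rest} → drop k I ≡ r ∷ rest →
                 locAt I k ≡ just (proj₂ r) × arrAt I k ≡ just (proj₁ r)
  drop-located (_ ∷ I) zero    refl    = refl , refl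
  drop-located (_ ∷ I) (suc k) dropped = drop-located I k dropped

  distIdx-located : ∀ d (I : List (Request n)) {i j x y} → locAt I i ≡ just x → locAt I j ≡ just y →
                    distIdx d I i j ≡ d x y
  distIdx-located d I {i} {j} eᵢ eⱼ with locAt I i | locAt I j
  distIdx-located d I refl refl | just _ | just _ = refl

  distIdx-uniform-≤1 : ∀ (I : List (Request n)) i j → distIdx uniform I i j ≤ 1
  distIdx-uniform-≤1 I i j with locAt I i | locAt I j
  ... | just x  | just y  = uniform-≤1 x y
  ... | just _  | nothing = z≤n
  ... | nothing | _       = z≤n

  lastArrival : ℕ → List (Request n) → ℕ
  lastArrival now []       = now
  lastArrival _   (r ∷ rs) = lastArrival (proj₁ r) rs

  lastArrival-≤ : ∀ {now t} xs → now ≤ t → All (λ r → proj₁ r ≤ t) xs → lastArrival now xs ≤ t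
  lastArrival-≤ []       now≤t _          = now≤t
  lastArrival-≤ (r ∷ rs) _     (r≤t ∷ rs≤t) = lastArrival-≤ rs r≤t rs≤t

  lastArrival-∷ʳ : ∀ now (xs : List (Request n)) r → lastArrival now (xs ∷ʳ r) ≡ proj₁ r
  lastArrival-∷ʳ now []       r = refl
  lastArrival-∷ʳ now (x ∷ xs) r = lastArrival-∷ʳ (proj₁ x) xs r

  ArrivalOrdered : List (Request n) → Set
  ArrivalOrdered = AllPairs (λ r s → proj₁ r ≤ proj₁ s)

length-pairIdx : ∀ S → length (pairIdx S) ≡ 2 * length S
length-pairIdx []      = refl
length-pairIdx (_ ∷ S) = trans (cong (suc ∘ suc) (length-pairIdx S)) (sym (*-suc 2 (length S)))

horizon-≤ : ∀ {T} S → All (λ q → matchTime q ≤ T) S → horizon S ≤ suc T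
horizon-≤ S = s≤s ∘ bound S
  where
    bound : ∀ {T} S → All (λ q → matchTime q ≤ T) S → foldr (λ q τ → matchTime q ⊔ τ) 0 S ≤ T
    bound []      []               = z≤n
    bound (q ∷ S) (q≤T ∷ S≤T) = ⊔-lub q≤T (bound S S≤T)

-- Online algorithms and their pending requests

algRun-cong : ∀ {n} (A : OnlineAlgorithm n) d g I J T → (∀ s → s < T → arrived s I ≡ arrived s J) →
              algRun A d g I T ≡ algRun A d g J T
algRun-cong A d g I J zero _ = refl
algRun-cong A d g I J (suc T) same
  rewrite algRun-cong A d g I J T (λ s s<T → same s (m<n⇒m<1+n s<T)) | same T ≤-refl = refl

memℕ≡false⇒∉ : ∀ {i M} → memℕ i M ≡ false → i ∉ M
memℕ≡false⇒∉ {i} {M} ≡false i∈M =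
  subst T ≡false (any⁺ _ (Any.map (λ i≡k → fromWitness (sym i≡k)) i∈M))

module _ {n : ℕ} where

  record Consistent (R : List (Request n)) (M : List ℕ) : Set where
    field
      matched-unique  : Unique M
      matched-arrived : All (_< length R) M
      unmatched-apart : ∀ {i j x} → i ∉ M → j ∉ M → locAt R i ≡ just x → locAt R j ≡ just x → i ≡ j

  applyPairs-consistent : ∀ {d} → IsMetric d → ∀ R M ps → Consistent R M →
    let (M′ , cost) = applyPairs d R M ps in Consistent R M′ × length M′ ≤ length M + 2 * cost
  applyPairs-consistent d-metric R M [] con = con , m≤m+n _ _
  applyPairs-consistent {d} d-metric R M ((i , j) ∷ ps) con
    with locAt R i in ei | locAt R j in ej | i ≟ j | memℕ i M in mi | memℕ j M in mj
  ... | just x | just y | no i≢j | false | false =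
    proj₁ rest , (begin
      length (proj₁ (applyPairs d R (i ∷ j ∷ M) ps)) ≤⟨ proj₂ rest ⟩
      2 + length M + 2 * cost                        ≡⟨ regroup (length M) cost ⟩
      length M + 2 * (1 + cost)                      ≤⟨ +-monoʳ-≤ (length M) (*-monoʳ-≤ 2 (+-monoˡ-≤ cost 1≤dxy)) ⟩
      length M + 2 * (d x y + cost)                  ∎)
    where
      open ≤-Reasoning
      open Consistent con
      regroup : ∀ L c → 2 + L + 2 * c ≡ L + 2 * (1 + c)
      regroup = solve-∀
      i∉M = memℕ≡false⇒∉ mi
      j∉M = memℕ≡false⇒∉ mj
      x≢y : x ≢ y
      x≢y x≡y = i≢j (unmatched-apart i∉M j∉M ei (subst (λ z → locAt R j ≡ just z) (sym x≡y) ej))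
      1≤dxy : 1 ≤ d x y
      1≤dxy = n≢0⇒n>0 (x≢y ∘ proj₁ (proj₂ d-metric) x y)
      extended : Consistent R (i ∷ j ∷ M)
      extended = record
        { matched-unique  = (i≢j ∷ All.¬Any⇒All¬ M i∉M) ∷ All.¬Any⇒All¬ M j∉M ∷ matched-unique
        ; matched-arrived = locAt-< R i ei ∷ locAt-< R j ej ∷ matched-arrived
        ; unmatched-apart = λ k∉ l∉ → unmatched-apart (k∉ ∘ there ∘ there) (l∉ ∘ there ∘ there)
        }
      rest = applyPairs-consistent d-metric R (i ∷ j ∷ M) ps extended
      cost = proj₂ (applyPairs d R (i ∷ j ∷ M) ps)
  ... | just x | just y | yes _  | _     | _     = applyPairs-consistent d-metric R M ps con
  ... | just x | just y | no _   | true  | _     = applyPairs-consistent d-metric R M ps con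
  ... | just x | just y | no _   | false | true  = applyPairs-consistent d-metric R M ps con
  ... | just x | nothing | _ | _ | _ = applyPairs-consistent d-metric R M ps con
  ... | nothing | _ | _ | _ | _ = applyPairs-consistent d-metric R M ps con

  Occupied : List (Request n) → List ℕ → Fin n → Set
  Occupied R M p = ∃ λ i → i < length R × (i ∉ M × locAt R i ≡ just p)

  occupied? : ∀ R M p → Dec (Occupied R M p)
  occupied? R M p = anyUpTo? (λ i → ¬? (i ∈ℕ? M) ×-dec Maybe.≡-dec Fin._≟_ (locAt R i) (just p)) (length R)

  occupied-everywhere : ∀ {R M} → Consistent R M → (∀ p → Occupied R M p) → n + length M ≤ length R
  occupied-everywhere {R} {M} con occupied = begin
    n + length M                 ≡⟨ cong (_+ length M) (List.length-tabulate (λ i → i)) ⟨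
    length (allFin n) + length M ≡⟨ cong (_+ length M) (List.length-map occupant (allFin n)) ⟨
    length occupants + length M  ≡⟨ List.length-++ occupants ⟨
    length (occupants ++ M)      ≤⟨ Unique⇒length≤bound distinct bounded ⟩
    length R                     ∎
    where
      open ≤-Reasoning
      open Consistent con
      occupant : Fin n → ℕ
      occupant p = proj₁ (occupied p)
      occupant-arrived : ∀ p → occupant p < length R
      occupant-arrived p = proj₁ (proj₂ (occupied p))
      occupant-unmatched : ∀ p → occupant p ∉ M
      occupant-unmatched p = proj₁ (proj₂ (proj₂ (occupied p)))
      occupant-located : ∀ p → locAt R (occupant p) ≡ just p
      occupant-located p = proj₂ (proj₂ (proj₂ (occupied p)))
      occupants = map occupant (allFin n)
      occupant-injective : ∀ {p q} → occupant p ≡ occupant q → p ≡ q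
      occupant-injective {p} {q} eq =
        Maybe.just-injective (trans (sym (occupant-located p)) (trans (cong (locAt R) eq) (occupant-located q)))
      distinct : Unique (occupants ++ M)
      distinct = Unique.++⁺ (Unique.map⁺ occupant-injective (Unique.allFin⁺ n)) matched-unique λ (v∈ , v∈M) →
        let (p , _ , v≡) = ∈-map⁻ occupant v∈ in occupant-unmatched p (subst (_∈ M) v≡ v∈M)
      bounded : All (_< length R) (occupants ++ M)
      bounded = All.++⁺ (All.map⁺ (All.universal occupant-arrived (allFin n))) matched-arrived

  consistent-∷ʳ : ∀ {R M} r → Consistent R M → ¬ Occupied R M (proj₂ r) → Consistent (R ∷ʳ r) M
  consistent-∷ʳ {R} {M} r con unoccupied = record
    { matched-unique  = matched-unique
    ; matched-arrived = All.map (λ i<R → ≤-trans i<R R≤R∷ʳr) matched-arrived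
    ; unmatched-apart = apart
    }
    where
      open Consistent con
      R≤R∷ʳr : length R ≤ length (R ∷ʳ r)
      R≤R∷ʳr = subst (length R ≤_) (sym (List.length-++ R)) (m≤m+n _ _)
      apart : ∀ {i j x} → i ∉ M → j ∉ M →
              locAt (R ∷ʳ r) i ≡ just x → locAt (R ∷ʳ r) j ≡ just x → i ≡ j
      apart {i} {j} i∉M j∉M eᵢ eⱼ with locAt-∷ʳ R r i eᵢ | locAt-∷ʳ R r j eⱼ
      ... | inj₁ eᵢ′        | inj₁ eⱼ′        = unmatched-apart i∉M j∉M eᵢ′ eⱼ′
      ... | inj₁ eᵢ′        | inj₂ (_ , refl) = ⊥-elim (unoccupied (i , locAt-< R i eᵢ′ , i∉M , eᵢ′))
      ... | inj₂ (_ , refl) | inj₁ eⱼ′        = ⊥-elim (unoccupied (j , locAt-< R j eⱼ′ , j∉M , eⱼ′))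
      ... | inj₂ (i≡ , _)   | inj₂ (j≡ , _)   = trans i≡ (sym j≡)

vacant : ∀ {n} → List (Request (suc n)) → List ℕ → Fin (suc n)
vacant R M with Fin.any? (¬? ∘ occupied? R M)
... | yes (p , _) = p
... | no _        = Fin.zero

vacant-unoccupied : ∀ {n} {R : List (Request (suc n))} {M} → Consistent R M → length R ∸ length M < suc n →
                    ¬ Occupied R M (vacant R M)
vacant-unoccupied {n} {R} {M} con few with Fin.any? (¬? ∘ occupied? R M)
... | yes (_ , unoccupied) = unoccupied
... | no none = ⊥-elim (<⇒≱ few (m+n≤o⇒m≤o∸n (suc n) (occupied-everywhere con λ p →
        decidable-stable (occupied? R M p) (λ unoccupied → none (p , unoccupied)))))

-- The adversarial instance

module Adversary (m a : ℕ) (A : OnlineAlgorithm (suc m)) where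

  N : ℕ
  N = suc m

  -- Exceeding a, so that paying it beats a times an offline cost of at most 1.
  penalty : ℕ
  penalty = N + a

  d : Fin N → Fin N → ℕ
  d = uniform

  g : ℕ → ℕ → ℕ
  g = cliffDelay N penalty

  -- algRun A d g I (suc t) is definitionally timestep t (arrived t I) (algRun A d g I t).
  timestep : ℕ → List (Request N) → List ℕ × ℕ → List ℕ × ℕ
  timestep t R (M , c) = proj₁ r , c + proj₂ r + g t (length R ∸ length (proj₁ r))
    where r = applyPairs d R M (A d t R (map g (upTo (suc t))))

  Outcome : List (Request N) → List ℕ × ℕ → Set
  Outcome R (M , c) = penalty ≤ c ⊎ (Consistent R M × length M ≤ 2 * c × length R ∸ length M < N)

  timestep-outcome : ∀ t R M c → Consistent R M → length M ≤ 2 * c → Outcome R (timestep t R (M , c))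
  timestep-outcome t R M c con M≤2c = by-unmatched (≤-<-connex N (length R ∸ length M′))
    where
      ps = A d t R (map g (upTo (suc t)))
      M′ = proj₁ (applyPairs d R M ps)
      cost = proj₂ (applyPairs d R M ps)
      c′ = c + cost + g t (length R ∸ length M′)
      con′ = proj₁ (applyPairs-consistent uniform-isMetric R M ps con)
      M′≤2c′ : length M′ ≤ 2 * c′
      M′≤2c′ = begin
        length M′            ≤⟨ proj₂ (applyPairs-consistent uniform-isMetric R M ps con) ⟩
        length M + 2 * cost  ≤⟨ +-monoˡ-≤ (2 * cost) M≤2c ⟩
        2 * c + 2 * cost     ≡⟨ *-distribˡ-+ 2 c cost ⟨
        2 * (c + cost)       ≤⟨ *-monoʳ-≤ 2 (m≤m+n (c + cost) _) ⟩
        2 * c′               ∎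
        where open ≤-Reasoning
      by-unmatched : N ≤ length R ∸ length M′ ⊎ length R ∸ length M′ < N → Outcome R (M′ , c′)
      by-unmatched (inj₁ full) = inj₁ (≤-trans (≤-reflexive (sym (cliffDelay-full full))) (m≤n+m _ _))
      by-unmatched (inj₂ few)  = inj₂ (con′ , M′≤2c′ , few)

  timestep-cost-mono : ∀ t R st → proj₂ st ≤ proj₂ (timestep t R st)
  timestep-cost-mono t R (M , c) = ≤-trans (m≤m+n _ _) (m≤m+n _ _)

  setup : List (Request N)
  setup = tabulate (λ i → 0 , Fin.suc i)

  setup-consistent : Consistent setup []
  setup-consistent = record
    { matched-unique  = []
    ; matched-arrived = []
    ; unmatched-apart = λ _ _ → locAt-injective setup setup-points-unique
    }
    where
      setup-points-unique : Unique (map proj₂ setup)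
      setup-points-unique = subst Unique (sym (List.map-tabulate _ proj₂)) (Unique.tabulate⁺ Fin.suc-injective)

  build : ℕ → List (Request N)
  next : ℕ → Fin N
  build zero    = setup
  build (suc t) = build t ∷ʳ (suc t , next t)
  next t = vacant (build t) (proj₁ (algRun A d g (build t) (suc t)))

  length-build : ∀ t → length (build t) ≡ m + t
  length-build zero    = trans (List.length-tabulate _) (sym (+-identityʳ m))
  length-build (suc t) = begin
    length (build t ∷ʳ (suc t , next t)) ≡⟨ List.length-++ (build t) ⟩
    length (build t) + 1                 ≡⟨ cong (_+ 1) (length-build t) ⟩
    m + t + 1                            ≡⟨ +-assoc m t 1 ⟩
    m + (t + 1)                          ≡⟨ cong (m +_) (+-comm t 1) ⟩
    m + suc t                            ∎
    where open ≡-Reasoning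

  build-arrivals : ∀ t → All (λ r → proj₁ r ≤ t) (build t)
  build-arrivals zero    = All.tabulate⁺ (λ _ → z≤n)
  build-arrivals (suc t) = All.++⁺ (All.map m≤n⇒m≤1+n (build-arrivals t)) (≤-refl ∷ [])

  build-ordered : ∀ t → ArrivalOrdered (build t)
  build-ordered zero    = AllPairs.tabulate⁺ (λ _ → z≤n)
  build-ordered (suc t) =
    AllPairs.++⁺ (build-ordered t) ([] ∷ []) (All.map (λ r≤t → m≤n⇒m≤1+n r≤t ∷ []) (build-arrivals t))

  build-extends : ∀ {t t′} → t ≤ t′ → ∃ λ ys → build t′ ≡ build t ++ ys × All (λ r → t < proj₁ r) ys
  build-extends {t} {zero} z≤n = [] , sym (List.++-identityʳ _) , []
  build-extends {t} {suc t′} t≤1+t′ with m≤n⇒m<n∨m≡n t≤1+t′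
  ... | inj₂ refl = [] , sym (List.++-identityʳ _) , []
  ... | inj₁ t<1+t′ =
    let (ys , build-t′ , later) = build-extends (≤-pred t<1+t′)
    in ys ∷ʳ (suc t′ , next t′) ,
       trans (cong (_∷ʳ (suc t′ , next t′)) build-t′) (List.++-assoc (build t) ys _) ,
       All.++⁺ later (t<1+t′ ∷ [])

  arrived-build : ∀ {s t} → s ≤ t → arrived s (build t) ≡ build s
  arrived-build {s} s≤t =
    let (ys , build-t , later) = build-extends s≤t
    in trans (cong (arrived s) build-t) (trans (arrived-++-later {xs = build s} ys later) (arrived-all (build-arrivals s)))

  module Online (I : List (Request N)) (agrees : ∀ {s} → s ≤ m → arrived s I ≡ build s) where

    online-outcome : ∀ t → t ≤ m → Outcome (build t) (algRun A d g I (suc t))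
    online-outcome zero _ =
      subst (λ R → Outcome setup (timestep 0 R ([] , 0))) (sym (agrees z≤n))
            (timestep-outcome 0 setup [] 0 setup-consistent z≤n)
    online-outcome (suc t) t<m =
      subst (λ R → Outcome (build (suc t)) (timestep (suc t) R (M , c))) (sym (agrees t<m))
            (extend (online-outcome t (<⇒≤ t<m)))
      where
        M = proj₁ (algRun A d g I (suc t))
        c = proj₂ (algRun A d g I (suc t))
        same-run : algRun A d g (build t) (suc t) ≡ algRun A d g I (suc t)
        same-run = algRun-cong A d g (build t) I (suc t) λ s s<1+t →
          trans (arrived-build (≤-pred s<1+t)) (sym (agrees (≤-trans (≤-pred s<1+t) (<⇒≤ t<m))))
        extend : Outcome (build t) (M , c) → Outcome (build (suc t)) (timestep (suc t) (build (suc t)) (M , c))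
        extend (inj₁ penalised) = inj₁ (≤-trans penalised (timestep-cost-mono (suc t) (build (suc t)) (M , c)))
        extend (inj₂ (con , M≤2c , few)) =
          timestep-outcome (suc t) (build (suc t)) M c (consistent-∷ʳ (suc t , next t) con next-unoccupied) M≤2c
          where
            next-unoccupied : ¬ Occupied (build t) M (next t)
            next-unoccupied = subst (λ st → ¬ Occupied (build t) M (vacant (build t) (proj₁ st))) (sym same-run)
                                    (vacant-unoccupied con few)

    online-cost : penalty ≤ algCost A d g I N ⊎ m ≤ 2 * algCost A d g I N
    online-cost with online-outcome m ≤-refl
    ... | inj₁ penalised = inj₁ penalised
    ... | inj₂ (_ , M≤2c , few) =
      inj₂ (≤-trans (half-matched (subst (λ L → L ∸ length M < N) (length-build m) few)) M≤2c)
      where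
        M = proj₁ (algRun A d g I N)
        half-matched : ∀ {L} → m + m ∸ L < suc m → m ≤ L
        half-matched {L} few′ = +-cancelʳ-≤ m m L (≤-trans (m≤n+m∸n (m + m) L) (+-monoʳ-≤ L (≤-pred few′)))

  -- The offline solution

  laterPoints : ℕ → List (Fin N)
  laterPoints zero    = []
  laterPoints (suc t) = next t ∷ laterPoints t

  length-laterPoints : ∀ t → length (laterPoints t) ≡ t
  length-laterPoints zero    = refl
  length-laterPoints (suc t) = cong suc (length-laterPoints t)

  next∈laterPoints : ∀ {s t} → s < t → next s ∈ laterPoints t
  next∈laterPoints {s} {suc t} s<1+t with m≤n⇒m<n∨m≡n (≤-pred s<1+t)
  ... | inj₁ s<t  = there (next∈laterPoints s<t)
  ... | inj₂ refl = here refl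

  unvisited : ∃ λ p → p ∉ laterPoints m
  unvisited = length<⇒∃∉ (laterPoints m) (subst (_< N) (sym (length-laterPoints m)) ≤-refl)

  w : Fin N
  w = proj₁ unvisited

  Avoids : Request N → Set
  Avoids (zero  , p) = p ≢ Fin.zero
  Avoids (suc _ , p) = p ≢ w

  build-avoids : ∀ {t} → t ≤ m → All Avoids (build t)
  build-avoids {zero}  _   = All.tabulate⁺ (λ _ ())
  build-avoids {suc t} t<m = All.++⁺ (build-avoids (<⇒≤ t<m)) (next≢w ∷ [])
    where
      next≢w : next t ≢ w
      next≢w next≡w = proj₂ unvisited (subst (_∈ laterPoints m) next≡w (next∈laterPoints t<m))

  record Entry : Set where
    constructor entry
    field
      index : ℕ
      point : Fin N
  open Entry

  extractAt : Fin N → List Entry → Maybe (Entry × List Entry)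
  extractAt p = extract (λ e → point e Fin.≟ p)

  OfflineState : Set
  OfflineState = OfflineSolution × List Entry

  greedy : ℕ → Request N → OfflineState → OfflineState
  greedy k (τ , p) (S , P) with extractAt p P
  ... | just (e , P′) = (index e , k , τ) ∷ S , P′
  ... | nothing       = S , entry k p ∷ P

  offlineStep : ℕ → Request N → OfflineState → OfflineState
  offlineStep k (zero  , p) st      = greedy k (zero , p) st
  offlineStep k (suc τ , p) (S , P) with extractAt w P
  ... | just (e , P′) = (index e , k , suc τ) ∷ S , P′
  ... | nothing       = greedy k (suc τ , p) (S , P)

  offlineRun : ℕ → List (Request N) → OfflineState → OfflineState
  offlineRun k []       st = st
  offlineRun k (r ∷ rs) st = offlineRun (suc k) rs (offlineStep k r st)

  offlineRun-++ : ∀ k xs ys st → offlineRun k (xs ++ ys) st ≡ offlineRun (k + length xs) ys (offlineRun k xs st)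
  offlineRun-++ k []       ys st = cong (λ k′ → offlineRun k′ ys st) (sym (+-identityʳ k))
  offlineRun-++ k (x ∷ xs) ys st = trans (offlineRun-++ (suc k) xs ys (offlineStep k x st))
    (cong (λ k′ → offlineRun k′ ys (offlineRun (suc k) xs (offlineStep k x st))) (sym (+-suc k (length xs))))

  offlineStep-appends : ∀ k r st →
    ∃ λ S′ → proj₁ (offlineStep k r st) ≡ S′ ++ proj₁ st × All (λ q → matchTime q ≡ proj₁ r) S′
  offlineStep-appends k (τ , p) (S , P) = by-time τ
    where
      greedy-appends : ∀ τ →
        ∃ λ S′ → proj₁ (greedy k (τ , p) (S , P)) ≡ S′ ++ S × All (λ q → matchTime q ≡ τ) S′
      greedy-appends τ with extractAt p P
      ... | just _  = _ , refl , refl ∷ []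
      ... | nothing = [] , refl , []
      by-time : ∀ τ →
        ∃ λ S′ → proj₁ (offlineStep k (τ , p) (S , P)) ≡ S′ ++ S × All (λ q → matchTime q ≡ τ) S′
      by-time zero = greedy-appends zero
      by-time (suc τ) with extractAt w P
      ... | just _  = _ , refl , refl ∷ []
      ... | nothing = greedy-appends (suc τ)

  offlineRun-appends : ∀ {t} k xs st → All (λ r → t < proj₁ r) xs →
                       ∃ λ S′ → proj₁ (offlineRun k xs st) ≡ S′ ++ proj₁ st × All (λ q → t < matchTime q) S′
  offlineRun-appends k []       st _ = [] , refl , []
  offlineRun-appends {t} k (x ∷ xs) st (t<x ∷ t<xs) =
    let (S₁ , step≡ , S₁-at-x) = offlineStep-appends k x st
        (S₂ , run≡ , S₂-late)  = offlineRun-appends (suc k) xs (offlineStep k x st) t<xs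
    in S₂ ++ S₁ ,
       trans run≡ (trans (cong (S₂ ++_) step≡) (sym (List.++-assoc S₂ S₁ _))) ,
       All.++⁺ S₂-late (All.map (λ matched≡x → subst (t <_) (sym matched≡x) t<x) S₁-at-x)

  closeouts : List Entry → List (Request N)
  closeouts = map (λ e → N , point e)

  offlineStep-late : ∀ k τ p S P → All (λ e → point e ≢ w) P →
                     offlineStep k (suc τ , p) (S , P) ≡ greedy k (suc τ , p) (S , P)
  offlineStep-late k τ p S P P≢w with extractAt w P | extract-none (λ e → point e Fin.≟ w) P≢w
  ... | _ | refl = refl

  greedy-partnered : ∀ k τ p S P {e P′} → extractAt p P ≡ just (e , P′) →
                     greedy k (τ , p) (S , P) ≡ ((index e , k , τ) ∷ S , P′)
  greedy-partnered k τ p S P found with extractAt p P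
  greedy-partnered k τ p S P refl | just _ = refl

  closeouts-clear : ∀ k S P → All (λ e → point e ≢ w) P → proj₂ (offlineRun k (closeouts P) (S , P)) ≡ []
  closeouts-clear k S []       _ = refl
  closeouts-clear k S (e ∷ P) (e≢w ∷ P≢w)
    rewrite offlineStep-late k m (point e) S (e ∷ P) (e≢w ∷ P≢w)
          | greedy-partnered k N (point e) S (e ∷ P) (extract-here (λ e′ → point e′ Fin.≟ point e) P refl) =
    closeouts-clear (suc k) ((index e , k , N) ∷ S) P P≢w

  module Invariants (I : List (Request N)) where

    distance : OfflineSolution → ℕ
    distance S = sum (map (λ q → distIdx d I (proj₁ q) (proj₁ (proj₂ q))) S)

    Timely : ℕ → ℕ × ℕ × ℕ → Set
    Timely now q =
      (ArrivedBy I (proj₁ q) (matchTime q) × ArrivedBy I (proj₁ (proj₂ q)) (matchTime q)) × matchTime q ≤ now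

    Located : ℕ → Entry → Set
    Located now e = locAt I (index e) ≡ just (point e) × ArrivedBy I (index e) now

    Arrives : ℕ → Request N → Set
    Arrives k (τ , p) = locAt I k ≡ just p × arrAt I k ≡ just τ

    record Invariant (k now : ℕ) (S : OfflineSolution) (P : List Entry) (v : Fin N) (budget : ℕ) : Set where
      field
        covers          : pairIdx S ++ map index P ↭ upTo k
        pairs-timely    : All (Timely now) S
        pending-located : All (Located now) P
        within-budget   : distance S ≤ budget
        pending-apart   : Unique (map point P)
        pending-avoid   : All (λ e → point e ≢ v) P

    relax : ∀ {k now S P v v′ B B′} → Invariant k now S P v B → All (λ e → point e ≢ v′) P → B ≤ B′ →
            Invariant k now S P v′ B′
    relax inv avoid B≤B′ = record
      { covers = covers ; pairs-timely = pairs-timely ; pending-located = pending-located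
      ; within-budget = ≤-trans within-budget B≤B′ ; pending-apart = pending-apart ; pending-avoid = avoid }
      where open Invariant inv

    timely-later : ∀ {now now′} → now ≤ now′ → ∀ {S} → All (Timely now) S → All (Timely now′) S
    timely-later now≤ = All.map λ (arrivals , matched≤) → arrivals , ≤-trans matched≤ now≤

    located-later : ∀ {now now′} → now ≤ now′ → ∀ {P} → All (Located now) P → All (Located now′) P
    located-later now≤ = All.map λ (at , by-now) → at , arrivedBy-mono I now≤ by-now

    match : ∀ {k now S P v B e P′ τ p} → Invariant k now S P v B → P ↭ e ∷ P′ →
            Arrives k (τ , p) → now ≤ τ →
            Invariant (suc k) τ ((index e , k , τ) ∷ S) P′ v (distIdx d I (index e) k + B)
    match {k} {now} {S} {P} {v} {B} {e} {P′} {τ} {p} inv P↭ (_ , arr-k) now≤τ = record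
      { covers          = covers′
      ; pairs-timely    = ((arrivedBy-mono I now≤τ (proj₂ (All.head located)) , arrivedBy-arrAt I arr-k) , ≤-refl)
                          ∷ timely-later now≤τ pairs-timely
      ; pending-located = located-later now≤τ (All.tail located)
      ; within-budget   = +-monoʳ-≤ (distIdx d I (index e) k) within-budget
      ; pending-apart   = AllPairs.tail (Unique-resp-↭ (Perm.map⁺ point P↭) pending-apart)
      ; pending-avoid   = All.tail (Perm.All-resp-↭ P↭ pending-avoid)
      }
      where
        open Invariant inv
        located = Perm.All-resp-↭ P↭ pending-located
        covers′ : index e ∷ k ∷ (pairIdx S ++ map index P′) ↭ upTo (suc k)
        covers′ = begin
          index e ∷ k ∷ (pairIdx S ++ map index P′)  <<⟨ ↭-refl ⟩
          k ∷ (index e ∷ (pairIdx S ++ map index P′)) <⟨ ↭-sym (Perm.shift (index e) (pairIdx S) (map index P′)) ⟩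
          k ∷ (pairIdx S ++ index e ∷ map index P′)   <⟨ Perm.++⁺ˡ (pairIdx S) (↭-sym (Perm.map⁺ index P↭)) ⟩
          k ∷ (pairIdx S ++ map index P)             <⟨ covers ⟩
          (k ∷ upTo k)                               ↭⟨ upTo-suc↭ k ⟨
          upTo (suc k)                               ∎
          where open PermutationReasoning

    wait : ∀ {k now S P v B τ p} → Invariant k now S P v B → All (λ e → point e ≢ p) P → Arrives k (τ , p) →
           now ≤ τ → p ≢ v → Invariant (suc k) τ S (entry k p ∷ P) v B
    wait {k} {now} {S} {P} {v} {B} {τ} {p} inv unpartnered (at-k , arr-k) now≤τ p≢v = record
      { covers          = covers′
      ; pairs-timely    = timely-later now≤τ pairs-timely
      ; pending-located = (at-k , arrivedBy-arrAt I arr-k) ∷ located-later now≤τ pending-located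
      ; within-budget   = within-budget
      ; pending-apart   = All.map⁺ (All.map (_∘ sym) unpartnered) ∷ pending-apart
      ; pending-avoid   = p≢v ∷ pending-avoid
      }
      where
        open Invariant inv
        covers′ : pairIdx S ++ k ∷ map index P ↭ upTo (suc k)
        covers′ = begin
          (pairIdx S ++ k ∷ map index P) ↭⟨ Perm.shift k (pairIdx S) (map index P) ⟩
          k ∷ (pairIdx S ++ map index P) <⟨ covers ⟩
          (k ∷ upTo k)                   ↭⟨ upTo-suc↭ k ⟨
          upTo (suc k)                   ∎
          where open PermutationReasoning

    greedy-preserves : ∀ {k now S P v B τ p} → Invariant k now S P v B →
                       Arrives k (τ , p) → now ≤ τ → p ≢ v →
                       let (S′ , P′) = greedy k (τ , p) (S , P) in Invariant (suc k) τ S′ P′ v B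
    greedy-preserves {k} {P = P} {B = B} {p = p} inv arrives now≤τ p≢v with extractAt p P in found
    ... | just (e , P′) = relax matched (Invariant.pending-avoid matched) (≤-reflexive (cong (_+ B) no-distance))
      where
        extracted = extract-just _ P found
        matched = match inv (proj₂ extracted) arrives now≤τ
        e-located = proj₁ (All.head (Perm.All-resp-↭ (proj₂ extracted) (Invariant.pending-located inv)))
        no-distance : distIdx d I (index e) k ≡ 0
        no-distance = begin
          distIdx d I (index e) k ≡⟨ distIdx-located d I e-located (proj₁ arrives) ⟩
          d (point e) p           ≡⟨ cong (λ x → d x p) (proj₁ extracted) ⟩
          d p p                   ≡⟨ uniform-≡ p ⟩
          0                       ∎
          where open ≡-Reasoning
    ... | nothing = wait inv (extract-nothing _ P found) arrives now≤τ p≢v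

    detour-preserves : ∀ {k now S P e P′ τ p} → Invariant k now S P Fin.zero 0 → extractAt w P ≡ just (e , P′) →
                       Arrives k (τ , p) → now ≤ τ → Invariant (suc k) τ ((index e , k , τ) ∷ S) P′ w 1
    detour-preserves {k} {P = P} {e} inv found arrives now≤τ =
      relax matched w-cleared (+-monoˡ-≤ 0 (distIdx-uniform-≤1 I (index e) k))
      where
        extracted = extract-just _ P found
        matched = match inv (proj₂ extracted) arrives now≤τ
        w-cleared : All (λ e′ → point e′ ≢ w) _
        w-cleared = All.map⁻ (All.map (λ e≢ e′≡w → e≢ (trans (proj₁ extracted) (sym e′≡w)))
                      (AllPairs.head (Unique-resp-↭ (Perm.map⁺ point (proj₂ extracted)) (Invariant.pending-apart inv))))

    -- Until a request after time 0 is served, the pending requests come from the setup, hence avoid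
    -- point zero, and nothing was paid; afterwards they avoid w and the detour paid at most 1.
    avoided : ℕ → Fin N
    avoided zero    = Fin.zero
    avoided (suc _) = w

    budget : ℕ → ℕ
    budget zero    = 0
    budget (suc _) = 1

    OfflineInvariant : ℕ → ℕ → OfflineState → Set
    OfflineInvariant k now (S , P) = Invariant k now S P (avoided now) (budget now)

    step-preserves : ∀ {k now} r st → OfflineInvariant k now st → Arrives k r → now ≤ proj₁ r → Avoids r →
                     OfflineInvariant (suc k) (proj₁ r) (offlineStep k r st)
    step-preserves {now = zero}  (zero , p)  _       inv arrives now≤ avoids = greedy-preserves inv arrives now≤ avoids
    step-preserves {now = suc _} (zero , p)  _       _   _       ()    _
    step-preserves {now = zero}  (suc τ , p) (S , P) inv arrives now≤ avoids with extractAt w P in found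
    ... | just (e , P′) = detour-preserves inv found arrives now≤
    ... | nothing       = greedy-preserves (relax inv (extract-nothing _ P found) z≤n) arrives now≤ avoids
    step-preserves {now = suc _} (suc τ , p) (S , P) inv arrives now≤ avoids
      rewrite extract-none (λ e → point e Fin.≟ w) (Invariant.pending-avoid inv) =
      greedy-preserves inv arrives now≤ avoids

    run-preserves : ∀ k xs {rest} → drop k I ≡ xs ++ rest → ∀ {now} st → OfflineInvariant k now st →
                    All Avoids xs → ArrivalOrdered xs → All (λ r → now ≤ proj₁ r) xs →
                    OfflineInvariant (k + length xs) (lastArrival now xs) (offlineRun k xs st)
    run-preserves k [] _ st inv _ _ _ = subst (λ k′ → OfflineInvariant k′ _ st) (sym (+-identityʳ k)) inv
    run-preserves k (x ∷ xs) dropped st inv (avoids ∷ avoids′) (x≤xs ∷ sorted) (now≤x ∷ _) =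
      subst (λ k′ → OfflineInvariant k′ (lastArrival (proj₁ x) xs) (offlineRun k (x ∷ xs) st))
            (sym (+-suc k (length xs)))
        (run-preserves (suc k) xs (drop-∷ I k dropped) (offlineStep k x st)
          (step-preserves x st inv (drop-located I k dropped) now≤x avoids) avoids′ sorted x≤xs)

  closeouts-ordered : ∀ P → ArrivalOrdered (closeouts P)
  closeouts-ordered []      = []
  closeouts-ordered (_ ∷ P) = All.map⁺ (All.universal (λ _ → ≤-refl) P) ∷ closeouts-ordered P

  build-started : ∀ {t} → 1 ≤ t → 1 ≤ lastArrival 0 (build t)
  build-started {suc t} _ = subst (1 ≤_) (sym (lastArrival-∷ʳ 0 (build t) (suc t , next t))) (s≤s z≤n)

  module Solution (m≥1 : 1 ≤ m) where

    start : OfflineState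
    start = [] , []

    pendingAfterBuild : List Entry
    pendingAfterBuild = proj₂ (offlineRun 0 (build m) start)

    requests : List (Request N)
    requests = build m ++ closeouts pendingAfterBuild

    solution : OfflineSolution
    solution = proj₁ (offlineRun 0 requests start)

    open Invariants requests

    start-invariant : OfflineInvariant 0 0 start
    start-invariant = record
      { covers = ↭-refl ; pairs-timely = [] ; pending-located = [] ; within-budget = z≤n
      ; pending-apart = [] ; pending-avoid = [] }

    started : ∀ {k now S P} → 1 ≤ now → OfflineInvariant k now (S , P) → Invariant k now S P w 1
    started {now = suc _} _ inv = inv

    budget≤1 : ∀ now → budget now ≤ 1
    budget≤1 zero    = z≤n
    budget≤1 (suc _) = ≤-refl

    pendingAfterBuild-avoids-w : All (λ e → point e ≢ w) pendingAfterBuild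
    pendingAfterBuild-avoids-w = Invariant.pending-avoid (started (build-started m≥1)
      (run-preserves 0 (build m) refl start start-invariant (build-avoids ≤-refl) (build-ordered m)
                     (All.universal (λ _ → z≤n) _)))

    requests-avoid : All Avoids requests
    requests-avoid = All.++⁺ (build-avoids ≤-refl) (All.map⁺ pendingAfterBuild-avoids-w)

    requests-arrivals : All (λ r → proj₁ r ≤ N) requests
    requests-arrivals = All.++⁺ (All.map m≤n⇒m≤1+n (build-arrivals m))
                                (All.map⁺ (All.universal (λ _ → ≤-refl) pendingAfterBuild))

    closeouts-later : ∀ {t} → t < N → All (λ r → t < proj₁ r) (closeouts pendingAfterBuild)
    closeouts-later t<N = All.map⁺ (All.universal (λ _ → t<N) pendingAfterBuild)

    arrived-requests : ∀ {t} → t ≤ m → arrived t requests ≡ build t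
    arrived-requests t≤m =
      trans (arrived-++-later {xs = build m} _ (closeouts-later (s≤s t≤m))) (arrived-build t≤m)

    requests-ordered : ArrivalOrdered requests
    requests-ordered = AllPairs.++⁺ (build-ordered m) (closeouts-ordered pendingAfterBuild)
      (All.map (λ r≤m → All.map⁺ (All.universal (λ _ → m≤n⇒m≤1+n r≤m) pendingAfterBuild)) (build-arrivals m))

    final-invariant : OfflineInvariant (length requests) (lastArrival 0 requests) (offlineRun 0 requests start)
    final-invariant = run-preserves 0 requests (sym (List.++-identityʳ requests)) start start-invariant
                        requests-avoid requests-ordered (All.universal (λ _ → z≤n) requests)

    open Invariant final-invariant

    final-cleared : proj₂ (offlineRun 0 requests start) ≡ []
    final-cleared = trans (cong proj₂ (offlineRun-++ 0 (build m) (closeouts pendingAfterBuild) start))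
                          (closeouts-clear _ _ _ pendingAfterBuild-avoids-w)

    solution-valid : ValidOffline requests solution
    solution-valid = subst (_↭ upTo (length requests)) pairs-only covers , All.map proj₁ pairs-timely
      where
        pairs-only : pairIdx solution ++ map index (proj₂ (offlineRun 0 requests start)) ≡ pairIdx solution
        pairs-only = trans (cong (λ P → pairIdx solution ++ map index P) final-cleared) (List.++-identityʳ _)

    solution-horizon : horizon solution ≤ suc N
    solution-horizon = horizon-≤ solution (All.map (λ (_ , matched≤) → ≤-trans matched≤ now≤N) pairs-timely)
      where now≤N = lastArrival-≤ requests z≤n requests-arrivals

    unmatched-at-split : ∀ {t} pre post → requests ≡ pre ++ post → arrived t requests ≡ pre →
                         All Avoids pre → ArrivalOrdered pre →
                         All (λ r → proj₁ r ≤ t) pre → All (λ r → t < proj₁ r) post →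
                         offUnmatched requests solution t ≤ m
    unmatched-at-split {t} pre post split arrived≡pre pre-avoid pre-ordered pre≤t post>t =
      subst (_≤ m) (sym unmatched≡pending) pending≤m
      where
        prefix = offlineRun 0 pre start
        S₀ = proj₁ prefix
        P₀ = proj₂ prefix
        inv₀ : OfflineInvariant (length pre) (lastArrival 0 pre) prefix
        inv₀ = run-preserves 0 pre split start start-invariant pre-avoid pre-ordered (All.universal (λ _ → z≤n) pre)
        open Invariant inv₀
          renaming (covers to covers₀; pairs-timely to timely₀; pending-apart to apart₀; pending-avoid to avoid₀)
        later = offlineRun-appends (length pre) post prefix post>t
        solution≡ : solution ≡ proj₁ later ++ S₀
        solution≡ = trans (cong (λ I → proj₁ (offlineRun 0 I start)) split)
                          (trans (cong proj₁ (offlineRun-++ 0 pre post start)) (proj₁ (proj₂ later)))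
        matched-by-t : filter (λ q → matchTime q ≤? t) solution ≡ S₀
        matched-by-t = begin
          filter (λ q → matchTime q ≤? t) solution
            ≡⟨ cong (filter (λ q → matchTime q ≤? t)) solution≡ ⟩
          filter (λ q → matchTime q ≤? t) (proj₁ later ++ S₀)
            ≡⟨ List.filter-++ (λ q → matchTime q ≤? t) (proj₁ later) S₀ ⟩
          filter (λ q → matchTime q ≤? t) (proj₁ later) ++ filter (λ q → matchTime q ≤? t) S₀
            ≡⟨ cong₂ _++_ (List.filter-none (λ q → matchTime q ≤? t) (All.map <⇒≱ (proj₂ (proj₂ later))))
                          (List.filter-all (λ q → matchTime q ≤? t)
                            (All.map (λ (_ , matched≤) → ≤-trans matched≤ (lastArrival-≤ pre z≤n pre≤t)) timely₀)) ⟩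
          S₀ ∎
          where open ≡-Reasoning
        size : 2 * length S₀ + length P₀ ≡ length pre
        size = begin
          2 * length S₀ + length P₀                    ≡⟨ cong₂ _+_ (length-pairIdx S₀) (List.length-map index P₀) ⟨
          length (pairIdx S₀) + length (map index P₀)  ≡⟨ List.length-++ (pairIdx S₀) ⟨
          length (pairIdx S₀ ++ map index P₀)          ≡⟨ Perm.↭-length covers₀ ⟩
          length (upTo (length pre))                   ≡⟨ List.length-upTo (length pre) ⟩
          length pre                                   ∎
          where open ≡-Reasoning
        unmatched≡pending : offUnmatched requests solution t ≡ length P₀
        unmatched≡pending = begin
          length (arrived t requests) ∸ 2 * length (filter (λ q → matchTime q ≤? t) solution)
            ≡⟨ cong₂ (λ R S → length R ∸ 2 * length S) arrived≡pre matched-by-t ⟩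
          length pre ∸ 2 * length S₀          ≡⟨ cong (_∸ 2 * length S₀) size ⟨
          2 * length S₀ + length P₀ ∸ 2 * length S₀ ≡⟨ m+n∸m≡n (2 * length S₀) (length P₀) ⟩
          length P₀                           ∎
          where open ≡-Reasoning
        pending≤m : length P₀ ≤ m
        pending≤m = ≤-pred (subst (λ L → suc L ≤ N) (List.length-map point P₀)
                      (Unique⇒length≤n (All.map⁺ (All.map (_∘ sym) avoid₀) ∷ apart₀)))

    unmatched-≤ : ∀ t → t ≤ N → offUnmatched requests solution t ≤ m
    unmatched-≤ t t≤N with m≤n⇒m<n∨m≡n t≤N
    ... | inj₂ refl = unmatched-at-split requests [] (sym (List.++-identityʳ requests)) (arrived-all requests-arrivals)
                        requests-avoid requests-ordered requests-arrivals []
    ... | inj₁ t<N  =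
      let t≤m = ≤-pred t<N
          (ys , build-m , ys-later) = build-extends t≤m
      in unmatched-at-split (build t) (ys ++ closeouts pendingAfterBuild)
           (trans (cong (_++ closeouts pendingAfterBuild) build-m) (List.++-assoc (build t) ys _))
           (arrived-requests t≤m) (build-avoids t≤m) (build-ordered t) (build-arrivals t)
           (All.++⁺ ys-later (closeouts-later t<N))

    solution-cost≤1 : offCost d g requests solution ≤ 1
    solution-cost≤1 = begin
      offCost d g requests solution     ≡⟨ cong (distance solution +_) no-delay ⟩
      distance solution + 0             ≡⟨ +-identityʳ _ ⟩
      distance solution                 ≤⟨ ≤-trans within-budget (budget≤1 _) ⟩
      1                                 ∎
      where
        open ≤-Reasoning
        no-delay : sumUpTo (λ t → g t (offUnmatched requests solution t)) (horizon solution) ≡ 0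
        no-delay = sumUpTo-zero _ (horizon solution) λ t t<h →
          let t≤N = ≤-pred (≤-trans t<h solution-horizon) in cliffDelay-early (s≤s (unmatched-≤ t t≤N)) t≤N

    open Online requests arrived-requests public

-- The competitive ratio

competitive-gap : ∀ {m a b off C} → 1 ≤ m → 1 ≤ b → a * 4 < 1 * suc m * b → off ≤ 1 →
                  suc m + a ≤ C ⊎ m ≤ 2 * C → a * off < b * C
competitive-gap {m} {a} {b} {off} {C} m≥1 b≥1 gap off≤1 online = ≤-<-trans a*off≤a (a<bC online)
  where
    open ≤-Reasoning
    a*off≤a : a * off ≤ a
    a*off≤a = ≤-trans (*-monoʳ-≤ a off≤1) (≤-reflexive (*-identityʳ a))
    a<bC : suc m + a ≤ C ⊎ m ≤ 2 * C → a < b * C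
    a<bC (inj₁ penalised) = begin-strict
      a         <⟨ m<n+m a (s≤s z≤n) ⟩
      suc m + a ≤⟨ penalised ⟩
      C         ≤⟨ m≤n*m C b {{>-nonZero b≥1}} ⟩
      b * C     ∎
    a<bC (inj₂ m≤2C) = *-cancelˡ-< 4 a (b * C) (begin-strict
      4 * a         ≡⟨ *-comm 4 a ⟩
      a * 4         <⟨ gap ⟩
      1 * suc m * b ≡⟨ cong (_* b) (*-identityˡ (suc m)) ⟩
      suc m * b     ≤⟨ *-monoˡ-≤ b (+-monoˡ-≤ m m≥1) ⟩
      (m + m) * b   ≤⟨ *-monoˡ-≤ b (+-mono-≤ m≤2C m≤2C) ⟩
      (2 * C + 2 * C) * b ≡⟨ regroup C b ⟩
      4 * (b * C)   ∎)
      where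
        regroup : ∀ C b → (2 * C + 2 * C) * b ≡ 4 * (b * C)
        regroup = solve-∀

theorem4 : Σ[ p ∈ ℕ ] Σ[ q ∈ ℕ ] 1 ≤ p × 1 ≤ q × Σ[ n₀ ∈ ℕ ]
             ((n : ℕ) → n₀ ≤ n → (A : OnlineAlgorithm n) → (a b : ℕ) → 1 ≤ b →
               a * q < p * n * b →
               Σ[ d ∈ (Fin n → Fin n → ℕ) ] Σ[ g ∈ (ℕ → ℕ → ℕ) ]
               Σ[ I ∈ List (Request n) ] Σ[ S ∈ OfflineSolution ]
                 (IsMetric d × SizeBasedDelay g × SortedByArrival I ×
                  ValidOffline I S ×
                  ∃[ T ] (a * offCost d g I S < b * algCost A d g I T)))
theorem4 = 1 , 4 , s≤s z≤n , s≤s z≤n , 2 , λ where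
  (suc zero) (s≤s ())
  (suc (suc k)) _ A a b b≥1 gap →
    let open Adversary (suc k) a A
        open Solution (s≤s z≤n)
    in d , g , requests , solution , uniform-isMetric , cliffDelay-sizeBased (s≤s z≤n) (m≤m+n N a) ,
       AllPairs⇒Linked requests-ordered , solution-valid ,
       N , competitive-gap (s≤s z≤n) b≥1 gap solution-cost≤1 online-cost
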